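{- Let $s,i,j,r \in \mathbb{N}_0$ with $j \ge r$ and $r > i$. Then $b_{s,i,j,r} = 0$.
   Context: For $s,i,j,r \in \mathbb{N}_0$ with $j \ge r$, the integers $b_{s,i,j,r}$ are defined recursively by: $b_{s,i,0,0} = 1$; for $j \ge 1$, $b_{s,i,j,j} = b_{s,i,j-1,j-1}\cdot(-i+j-1)$ and $b_{s,i,j,0} = b_{s,i,j-1,0}\cdot(s+j-1)$; for $j > r \ge 1$, $b_{s,i,j,r} = b_{s,i,j-1,r}\cdot(s+j-1) + b_{s,i,j-1,r-1}\cdot(-i+r-1)$. -}

module Defs where

open import Data.Nat using (ℕ; zero; suc; _≟_)
open import Data.Integer using (ℤ; +_; _+_; _*_; -_)
open import Relation.Nullary using (yes; no)

-- Only the values with r ≤ j are meaningful; for r > j we set the value to 0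
-- (this junk value is never used by the recursion for r ≤ j, since the
-- diagonal case is handled separately).
b : ℕ → ℕ → ℕ → ℕ → ℤ
b s i zero zero = + 1
b s i zero (suc r) = + 0
b s i (suc j) zero = b s i j zero * (+ s + + j)
b s i (suc j) (suc r) with suc r ≟ suc j
... | yes _ = b s i j j * (- (+ i) + + j)
... | no _  = b s i j (suc r) * (+ s + + j) + b s i j r * (- (+ i) + + r)

-- In the recursion for b_{s,i,j+1,r+1} the column r+1 > i
-- is fed by column r+1 (zero by induction) and by column r with weight
-- r - i: either r > i and b_{s,i,j,r} vanishes by induction, or r = i and
-- the weight itself is 0.

{-# OPTIONS --safe #-}
module Submission where

open import Defs
open import Data.Nat using (ℕ; _≤_; _<_; zero; suc; s≤s; _≟_)
open import Data.Nat.Properties using (≤-refl; m≤n⇒m<n∨m≡n)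
open import Data.Integer using (+_; -_; _*_; _+_)
open import Data.Integer.Properties using (*-zeroˡ; *-zeroʳ; +-inverseˡ)
open import Data.Empty using (⊥-elim)
open import Data.Sum using (inj₁; inj₂)
open import Relation.Nullary using (yes; no)
open import Relation.Binary.PropositionalEquality using (_≡_; refl; cong₂)

ColumnsAboveVanish : ℕ → ℕ → ℕ → Set
ColumnsAboveVanish s i j = ∀ r → r ≤ j → i < r → b s i j r ≡ + 0

weighted-column-vanishes : ∀ s i j r → r ≤ j → i ≤ r → ColumnsAboveVanish s i j →
                           b s i j r * (- (+ i) + + r) ≡ + 0
weighted-column-vanishes s i j r r≤j i≤r vanish with m≤n⇒m<n∨m≡n i≤r
... | inj₁ i<r  rewrite vanish r r≤j i<r = *-zeroˡ (- (+ i) + + r)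
... | inj₂ refl rewrite +-inverseˡ (+ i) = *-zeroʳ (b s i j i)

proposition2p1 : (s i j r : ℕ) → r ≤ j → i < r → b s i j r ≡ + 0
proposition2p1 s i (suc j) (suc r) (s≤s r≤j) (s≤s i≤r) with suc r ≟ suc j
... | yes refl = weighted-column-vanishes s i j j ≤-refl i≤r (proposition2p1 s i j)
... | no r≢j with m≤n⇒m<n∨m≡n r≤j
...   | inj₂ refl = ⊥-elim (r≢j refl)
...   | inj₁ r<j  = cong₂ _+_ (cong₂ _*_ (proposition2p1 s i j (suc r) r<j (s≤s i≤r)) refl)
                              (weighted-column-vanishes s i j r r≤j i≤r (proposition2p1 s i j))
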